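{- Let $\mathbf A=(A,\le,0,1)$ be a bounded MLUB-complete poset, let $(T,R)$ be a time frame with $R$ a serial binary relation, and let $P,F,H,G$ be the tense operators on $\mathbf A$ induced by $(T,R)$. Then $(P,G)$ and $(F,H)$ are dynamic pairs. That is, for each $(X,Y)\in\{(P,G),(F,H)\}$ and all $C,D\in\mathcal P_+(A^T)$: (T0) $Y(\mathbf 1)=\mathbf 1$ and $X(\mathbf 0)=\mathbf 0$, where $\mathbf 1,\mathbf 0\in A^T$ are the constant functions with values $1$ and $0$; (T1) if $C\le_1 D$ then $X(C)\le_2 X(D)$, and if $C\le_2 D$ then $Y(C)\le_1 Y(D)$; (T2) $C\le_1 (Y*X)(C)$ and $(X*Y)(C)\le_2 C$.
   Context: For a poset $(A,\le)$ and $X\subseteq A$: $L(X)=\{a\in A\mid a\le x \text{ for all } x\in X\}$, $U(X)=\{a\in A\mid x\le a\text{ for all }x\in X\}$; $\operatorname{Max}X$, $\operatorname{Min}X$ are the sets of maximal, resp. minimal, elements of $X$. The poset is MLUB-complete if for every nonempty $M\subseteq A$, every upper bound of $M$ lies above some minimal upper bound of $M$, and every lower bound of $M$ lies below some maximal lower bound of $M$. $\mathcal P_+(X)$ is the set of nonempty subsets of $X$; a singleton $\{a\}$ is identified with $a$. For subsets $X,Y$ of a poset: $X\le Y$ means $x\le y$ for all $x\in X,y\in Y$; $X\le_1Y$ means every $x\in X$ is below some $y\in Y$; $X\le_2Y$ means every $y\in Y$ is above some $x\in X$. A time frame is a pair $(T,R)$, $T$ a nonempty set, $R$ a binary relation on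 $T$; $R$ is serial if for each $s\in T$ there are $r,t\in T$ with $rRs$ and $sRt$. $A^T$ is ordered componentwise and all of $L,U,\operatorname{Max},\operatorname{Min},\le,\le_1,\le_2$ for subsets of $A^T$ refer to this order. Each $Z\in(\mathcal P_+A)^T$ is identified with the subset $\varphi(Z)=\{q\in A^T\mid q(t)\in Z(t)\text{ for all }t\}$ of $A^T$; comparisons involving such $Z$ and applications of operators to $Z$ are made via this identification. The tense operators induced by $(T,R)$ are the maps $P,F,H,G:\mathcal P_+(A^T)\to(\mathcal P_+A)^T$ defined for $B\in\mathcal P_+(A^T)$, $s\in T$ by $P(B)(s)=\operatorname{Min}U(\{q(t)\mid q\in B,\ tRs\})$, $F(B)(s)=\operatorname{Min}U(\{q(t)\mid q\in B,\ sRt\})$, $H(B)(s)=\operatorname{Max}L(\{q(t)\mid q\in B,\ tRs\})$, $G(B)(s)=\operatorname{Max}L(\{q(t)\mid q\in B,\ sRt\})$. For maps $X,Y:\mathcal P_+(A^T)\to(\mathcal P_+A)^T$, $X*Y=X\circ\varphi\circ Y$. -}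

module Defs where

open import Level using (0ℓ)
open import Data.Product using (Σ; ∃; _×_; _,_)
open import Relation.Binary.PropositionalEquality using (_≡_)
open import Relation.Binary.Structures using (IsPartialOrder)
open import Relation.Unary using (Pred)
open import Function.Bundles using (_⇔_)

Subset : Set → Set₁
Subset X = Pred X 0ℓ

Nonempty : {X : Set} → Subset X → Set
Nonempty {X} S = Σ X S

module _ {A : Set} (_≤_ : A → A → Set) where

  L : Subset A → Subset A
  L X a = ∀ x → X x → a ≤ x

  U : Subset A → Subset A
  U X a = ∀ x → X x → x ≤ a

  Max : Subset A → Subset A
  Max X a = X a × (∀ b → X b → a ≤ b → b ≡ a)

  Min : Subset A → Subset A
  Min X a = X a × (∀ b → X b → b ≤ a → b ≡ a)

  MLUB-complete : Set₁
  MLUB-complete =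
    ∀ (M : Subset A) → Nonempty M →
      (∀ u → U M u → Σ A λ m → Min (U M) m × m ≤ u)
    × (∀ l → L M l → Σ A λ m → Max (L M) m × l ≤ m)

  _≤ₛ_ _≤₁_ _≤₂_ : Subset A → Subset A → Set
  X ≤ₛ Y = ∀ x y → X x → Y y → x ≤ y
  X ≤₁ Y = ∀ x → X x → Σ A λ y → Y y × x ≤ y
  X ≤₂ Y = ∀ y → Y y → Σ A λ x → X x × x ≤ y

record BoundedPoset : Set₁ where
  field
    Carrier : Set
    _≤_ : Carrier → Carrier → Set
    isPartialOrder : IsPartialOrder _≡_ _≤_
    𝟎 𝟏 : Carrier
    minimum : ∀ a → 𝟎 ≤ a
    maximum : ∀ a → a ≤ 𝟏

Serial : {T : Set} → (T → T → Set) → Set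
Serial {T} R = ∀ s → (Σ T λ r → R r s) × (Σ T λ t → R s t)

module _ {A T : Set} (_≤_ : A → A → Set) (R : T → T → Set) where

  _≤ᵀ_ : (T → A) → (T → A) → Set
  p ≤ᵀ q = ∀ t → p t ≤ q t

  φ : (T → Subset A) → Subset (T → A)
  φ Z q = ∀ t → Z t (q t)

  past : Subset (T → A) → T → Subset A
  past B s a = Σ (T → A) λ q → Σ T λ t → B q × R t s × q t ≡ a

  future : Subset (T → A) → T → Subset A
  future B s a = Σ (T → A) λ q → Σ T λ t → B q × R s t × q t ≡ a

  P F H G : Subset (T → A) → T → Subset A
  P B s = Min _≤_ (U _≤_ (past B s))
  F B s = Min _≤_ (U _≤_ (future B s))
  H B s = Max _≤_ (L _≤_ (past B s))
  G B s = Max _≤_ (L _≤_ (future B s))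

  _⊛_ : (Subset (T → A) → T → Subset A) → (Subset (T → A) → T → Subset A)
      → Subset (T → A) → T → Subset A
  (X ⊛ Y) B = X (φ (Y B))

  -- dynamic pair (T0)-(T2); 𝟎 𝟏 are the bottom/top of A
  DynamicPair : A → A →
    (Subset (T → A) → T → Subset A) → (Subset (T → A) → T → Subset A) → Set₁
  DynamicPair 𝟎 𝟏 X Y =
    ((∀ s a → Y (λ q → q ≡ (λ _ → 𝟏)) s a ⇔ (a ≡ 𝟏))
     × (∀ s a → X (λ q → q ≡ (λ _ → 𝟎)) s a ⇔ (a ≡ 𝟎)))
    × (∀ (C D : Subset (T → A)) → Nonempty C → Nonempty D →
         (_≤₁_ _≤ᵀ_ C D → _≤₂_ _≤ᵀ_ (φ (X C)) (φ (X D)))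
       × (_≤₂_ _≤ᵀ_ C D → _≤₁_ _≤ᵀ_ (φ (Y C)) (φ (Y D))))
    × (∀ (C : Subset (T → A)) → Nonempty C →
         _≤₁_ _≤ᵀ_ C (φ ((Y ⊛ X) C))
       × _≤₂_ _≤ᵀ_ (φ ((X ⊛ Y) C)) C)

{-# OPTIONS --safe #-}
module Submission where

-- Each tense operator takes, pointwise, the minimal upper bounds (or maximal
-- lower bounds) of a set of values that seriality makes nonempty, so
-- MLUB-completeness lets one choose such a bound below (above) any given
-- bound of that set; choosing pointwise yields (T1) and (T2). Reversing the
-- order and the time relation simultaneously exchanges P and G, and reversing
-- time alone exchanges (P, G) with (F, H), so only the statements about P
-- need a proof.

open import Defs
open import Data.Product using (Σ; _×_; _,_; proj₁; proj₂; swap)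
open import Function using (flip; const)
open import Function.Bundles using (_⇔_; mk⇔)
open import Relation.Binary.PropositionalEquality using (_≡_; refl; sym)
open import Relation.Binary.Structures using (IsPartialOrder)
import Relation.Binary.Construct.Flip.EqAndOrd as Flip

Π-Σ-distrib : {T A : Set} {Z Q : T → A → Set} →
  (∀ t → Σ A λ a → Z t a × Q t a) → Σ (T → A) λ p → (∀ t → Z t (p t)) × (∀ t → Q t (p t))
Π-Σ-distrib f = (λ t → proj₁ (f t)) , (λ t → proj₁ (proj₂ (f t))) , (λ t → proj₂ (proj₂ (f t)))

dual : BoundedPoset → BoundedPoset
dual 𝐀 = record
  { _≤_ = flip _≤_
  ; isPartialOrder = Flip.isPartialOrder isPartialOrder
  ; 𝟎 = 𝟏
  ; 𝟏 = 𝟎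
  ; minimum = maximum
  ; maximum = minimum
  }
  where open BoundedPoset 𝐀

MLUB-complete-flip : {A : Set} {_≤_ : A → A → Set} → MLUB-complete _≤_ → MLUB-complete (flip _≤_)
MLUB-complete-flip mlub M ne = swap (mlub M ne)

Serial-flip : {T : Set} {R : T → T → Set} → Serial R → Serial (flip R)
Serial-flip serial s = swap (serial s)

module TenseProperties (𝐀 : BoundedPoset) (mlub : MLUB-complete (BoundedPoset._≤_ 𝐀))
                       {T : Set} {R : T → T → Set} (serial : Serial R) where

  open BoundedPoset 𝐀 renaming (Carrier to A)
  open IsPartialOrder isPartialOrder using (antisym; trans)

  private
    Pᴿ Gᴿ : Subset (T → A) → T → Subset A
    Pᴿ = P _≤_ R
    Gᴿ = G _≤_ R

    φᴿ : (T → Subset A) → Subset (T → A)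
    φᴿ = φ _≤_ R

    _≤ᵗ_ : (T → A) → (T → A) → Set
    _≤ᵗ_ = _≤ᵀ_ _≤_ R

  min-upper-bound-below : {M : Subset A} {u : A} → Nonempty M → U _≤_ M u →
    Σ A λ m → Min _≤_ (U _≤_ M) m × m ≤ u
  min-upper-bound-below ne = proj₁ (mlub _ ne) _

  max-lower-bound-above : {M : Subset A} {l : A} → Nonempty M → L _≤_ M l →
    Σ A λ m → Max _≤_ (L _≤_ M) m × l ≤ m
  max-lower-bound-above ne = proj₂ (mlub _ ne) _

  past-nonempty : {C : Subset (T → A)} → Nonempty C → ∀ s → Nonempty (past _≤_ R C s)
  past-nonempty (c , c∈C) s = let r , rRs = proj₁ (serial s) in c r , c , r , c∈C , rRs , refl

  future-nonempty : {C : Subset (T → A)} → Nonempty C → ∀ s → Nonempty (future _≤_ R C s)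
  future-nonempty (c , c∈C) s = let t , sRt = proj₂ (serial s) in c t , c , t , c∈C , sRt , refl

  P-below : {C : Subset (T → A)} {y : T → A} → Nonempty C →
    (∀ s → U _≤_ (past _≤_ R C s) (y s)) → Σ (T → A) λ p → φᴿ (Pᴿ C) p × p ≤ᵗ y
  P-below neC y-ub = Π-Σ-distrib λ s → min-upper-bound-below (past-nonempty neC s) (y-ub s)

  G-above : {C : Subset (T → A)} {x : T → A} → Nonempty C →
    (∀ s → L _≤_ (future _≤_ R C s) (x s)) → Σ (T → A) λ p → φᴿ (Gᴿ C) p × x ≤ᵗ p
  G-above neC x-lb = Π-Σ-distrib λ s → max-lower-bound-above (future-nonempty neC s) (x-lb s)

  φP-nonempty : {C : Subset (T → A)} → Nonempty C → Nonempty (φᴿ (Pᴿ C))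
  φP-nonempty neC = let p , p∈PC , _ = P-below {y = const 𝟏} neC (λ s x _ → maximum x) in p , p∈PC

  Min-U⇔𝟎 : {X : Subset A} {a : A} → U _≤_ X 𝟎 → Min _≤_ (U _≤_ X) a ⇔ (a ≡ 𝟎)
  Min-U⇔𝟎 {a = a} 𝟎-ub = mk⇔ (λ (_ , minimal) → sym (minimal 𝟎 𝟎-ub (minimum a)))
                              λ { refl → 𝟎-ub , λ b _ b≤𝟎 → antisym b≤𝟎 (minimum b) }

  P-𝟎 : ∀ s a → Pᴿ (λ q → q ≡ const 𝟎) s a ⇔ (a ≡ 𝟎)
  P-𝟎 _ _ = Min-U⇔𝟎 λ { _ (_ , _ , refl , _ , refl) → minimum 𝟎 }

  ≤₁⇒U-past⊆ : {C D : Subset (T → A)} → _≤₁_ _≤ᵗ_ C D →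
    ∀ {s a} → U _≤_ (past _≤_ R D s) a → U _≤_ (past _≤_ R C s) a
  ≤₁⇒U-past⊆ C≤₁D a-ub _ (c , t , c∈C , tRs , refl) =
    let d , d∈D , c≤d = C≤₁D c c∈C in trans (c≤d t) (a-ub (d t) (d , t , d∈D , tRs , refl))

  P-mono : {C D : Subset (T → A)} → Nonempty C →
    _≤₁_ _≤ᵗ_ C D → _≤₂_ _≤ᵗ_ (φᴿ (Pᴿ C)) (φᴿ (Pᴿ D))
  P-mono neC C≤₁D y y∈PD = P-below neC λ s → ≤₁⇒U-past⊆ C≤₁D (proj₁ (y∈PD s))

  ∈⇒L-future-φP : {C : Subset (T → A)} {c : T → A} → C c →
    ∀ s → L _≤_ (future _≤_ R (φᴿ (Pᴿ C)) s) (c s)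
  ∈⇒L-future-φP {c = c} c∈C s _ (p , t , p∈PC , sRt , refl) =
    proj₁ (p∈PC t) (c s) (c , s , c∈C , sRt , refl)

  ≤₁-G∘P : {C : Subset (T → A)} → Nonempty C → _≤₁_ _≤ᵗ_ C (φᴿ (Gᴿ (φᴿ (Pᴿ C))))
  ≤₁-G∘P neC c c∈C = G-above (φP-nonempty neC) (∈⇒L-future-φP c∈C)

open BoundedPoset using (_≤_; 𝟎; 𝟏)

-- Reversing both the order and time turns P into G and G into P, definitionally.
P-G-dynamicPair : (𝐀 : BoundedPoset) → MLUB-complete (_≤_ 𝐀) →
  {T : Set} {R : T → T → Set} → Serial R →
  DynamicPair (_≤_ 𝐀) R (𝟎 𝐀) (𝟏 𝐀) (P (_≤_ 𝐀) R) (G (_≤_ 𝐀) R)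
P-G-dynamicPair 𝐀 mlub serial =
    (Dual.P-𝟎 , P-𝟎)
  , (λ _ _ neC neD → P-mono neC , Dual.P-mono neD)
  , (λ _ neC → ≤₁-G∘P neC , Dual.≤₁-G∘P neC)
  where
  open TenseProperties 𝐀 mlub serial
  module Dual = TenseProperties (dual 𝐀) (MLUB-complete-flip mlub) (Serial-flip serial)

theorem3p20 : (𝐀 : BoundedPoset) → MLUB-complete (_≤_ 𝐀) →
    (T : Set) (R : T → T → Set) → Serial R →
    DynamicPair (_≤_ 𝐀) R (𝟎 𝐀) (𝟏 𝐀) (P (_≤_ 𝐀) R) (G (_≤_ 𝐀) R)
    × DynamicPair (_≤_ 𝐀) R (𝟎 𝐀) (𝟏 𝐀) (F (_≤_ 𝐀) R) (H (_≤_ 𝐀) R)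
theorem3p20 𝐀 mlub T R serial =
  P-G-dynamicPair 𝐀 mlub serial , P-G-dynamicPair 𝐀 mlub (Serial-flip serial)
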